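{- There is a short $\mathbf{ResSV}$ refutation of $\mathit{SPHP}$: for every $m\ge1$ there is a proof $\mathit{SPHP}_m\vdash_{\mathbf{ResSV}}\{(\Box,1)\}$ whose length is bounded by a polynomial in $m$ (note $\mathrm{MaxSAT}(\mathit{SPHP}_m)=1$).
   Context: A literal is a Boolean variable $x$ or its negation $\overline x$; a clause is a disjunction of literals ($\Box$ is the empty clause). Weights are elements of $\mathbb{R}_{>0}\cup\{\infty\}$ with $\infty\pm w=\infty$; during $\mathbf{ResSV}$ proofs clauses may also carry finite negative weights. A MaxSAT formula is a finite collection of weighted clauses $(C,w)$, where $(C,u),(C,v)$ may be merged into $(C,u+v)$ and conversely, and weight-$0$ clauses disappear. Cost of an assignment is the sum of weights of falsified clauses; $\mathrm{MaxSAT}(\mathcal F)$ is the minimum cost. $\mathcal G\subseteq\mathcal H$ means every $(C,w)\in\mathcal G$ has some $(C,w')\in\mathcal H$ with $w\le w'$. A proof is a sequence $\mathcal F_0;\dots;\mathcal F_e$ (length $e$), each obtained from the previous by one rule application replacing antecedents by consequents; $\mathcal F\vdash_{\mathbf{ResSV}}\mathcal G$ means such a proof with $\mathcal F_0=\mathcal F$, $\mathcal G\subseteq\mathcal F_e$ and all clauses of $\mathcal F_e$ of positive weight. $\mathbf{ResSV}$ rules: Resolution: from $(x\lor A,v),(\overline x\lor B,w)$ with $v,w$ positive ($A,B$ possibly empty), with $m'=\min\{v,w\}$, derive $(A\lor B,m'),(x\lor A,v-m'),(\overline x\lor B,w-m'),(x\lor A\lor\overline B,m'),(\overline x\lor B\lor\overline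 A,m')$, where for $D=l_1\lor\dots\lor l_p$ the expression $(E\lor\overline D,u)$ stands for $(E\lor\overline{l_1},u),(E\lor l_1\lor\overline{l_2},u),\dots,(E\lor l_1\lor\dots\lor l_{p-1}\lor\overline{l_p},u)$ (nothing if $D$ is empty), tautologies discarded. Split: from $(A,w)$ with $w$ positive derive $(A\lor x,w),(A\lor\overline x,w)$. Virtual: with no antecedents, introduce $(A,w),(A,-w)$ for any clause $A$ and finite $w$. For $m\ge1$ take variables $x_{ij}$, $1\le i\le m+1$, $1\le j\le m$; let $\mathcal K_m$ consist of the clauses $x_{i1}\lor\dots\lor x_{im}$ for each $i$ and $\overline x_{ij}\lor\overline x_{i'j}$ for each $j$ and $1\le i<i'\le m+1$. $\mathit{SPHP}_m=\{(C,1)\mid C\in\mathcal K_m\}$. -}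

module Defs where

open import Data.Nat as ℕ using (ℕ; zero; suc)
open import Data.Product using (_×_; _,_; ∃; ∃-syntax; Σ-syntax; proj₁; proj₂)
open import Data.Product.Properties using (≡-dec)
open import Data.List using (List; []; _∷_; _++_; [_]; map; concatMap; upTo)
open import Data.Bool.ListAction using (any)
open import Data.List.Membership.Propositional using (_∈_)
open import Data.List.Relation.Binary.Subset.Propositional using () renaming (_⊆_ to _⊆ˡ_)
open import Data.List.Relation.Binary.Permutation.Propositional using (_↭_)
open import Data.List.Relation.Unary.All using (All)
open import Data.List.Relation.Unary.Any using (Any)
open import Data.Rational as ℚ using (ℚ; 0ℚ; 1ℚ; _⊓_) renaming (_+_ to _+q_; _-_ to _-q_; -_ to -q_; _<_ to _<q_; _≤_ to _≤q_)
open import Data.Bool using (Bool; true; false; not)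
open import Relation.Binary.PropositionalEquality using (_≡_; _≢_)
open import Relation.Nullary using (Dec; yes; no; ¬_)
open import Relation.Nullary.Decidable using (⌊_⌋)
open import Relation.Binary.Definitions using (DecidableEquality)
import Data.Nat.Properties as ℕP

-- Variables: pairs of naturals (an infinite supply); x_{ij} is (i , j).
Var : Set
Var = ℕ × ℕ

data Lit : Set where
  pos : Var → Lit
  neg : Var → Lit

_≟V_ : DecidableEquality Var
_≟V_ = ≡-dec ℕP._≟_ ℕP._≟_

compl : Lit → Lit
compl (pos x) = neg x
compl (neg x) = pos x

_≟L_ : DecidableEquality Lit
pos x ≟L pos y with x ≟V y
... | yes Relation.Binary.PropositionalEquality.refl = yes Relation.Binary.PropositionalEquality.refl
... | no ne = no λ { Relation.Binary.PropositionalEquality.refl → ne Relation.Binary.PropositionalEquality.refl }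
pos x ≟L neg y = no λ ()
neg x ≟L pos y = no λ ()
neg x ≟L neg y with x ≟V y
... | yes Relation.Binary.PropositionalEquality.refl = yes Relation.Binary.PropositionalEquality.refl
... | no ne = no λ { Relation.Binary.PropositionalEquality.refl → ne Relation.Binary.PropositionalEquality.refl }

-- A clause is a disjunction of literals, given as a list; two lists denote the
-- same clause when they contain the same literals (see _≐_).  [] is □.
Clause : Set
Clause = List Lit

_≐_ : Clause → Clause → Set
C ≐ D = (C ⊆ˡ D) × (D ⊆ˡ C)

memb : Lit → Clause → Bool
memb l C = any (λ l' → ⌊ l ≟L l' ⌋) C

isTaut : Clause → Bool
isTaut C = any (λ l → memb (compl l) C) C

WClause : Set
WClause = Clause × ℚ

Formula : Set
Formula = List WClause

dropTaut : Formula → Formula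
dropTaut [] = []
dropTaut ((C , w) ∷ F) with isTaut C
... | true  = dropTaut F
... | false = (C , w) ∷ dropTaut F

-- (E ∨ D̄) for D = l₁ ∨ … ∨ l_p :
--   E ∨ l̄₁ , E ∨ l₁ ∨ l̄₂ , … , E ∨ l₁ ∨ … ∨ l_{p-1} ∨ l̄_p
negExp : Clause → Clause → List Clause
negExp E []      = []
negExp E (l ∷ D) = (E ++ [ compl l ]) ∷ negExp (E ++ [ l ]) D

withW : ℚ → List Clause → Formula
withW u = map (λ C → (C , u))

resCons : Var → Clause → Clause → ℚ → ℚ → Formula
resCons x A B v w =
  let m' = v ⊓ w in
  dropTaut ( (A ++ B , m')
           ∷ (pos x ∷ A , v -q m')
           ∷ (neg x ∷ B , w -q m')
           ∷ (withW m' (negExp (pos x ∷ A) B) ++ withW m' (negExp (neg x ∷ B) A)))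

data Rule : Formula → Formula → Set where
  resolution : (x : Var) (A B : Clause) (v w : ℚ) → 0ℚ <q v → 0ℚ <q w →
               Rule ((pos x ∷ A , v) ∷ (neg x ∷ B , w) ∷ []) (resCons x A B v w)
  split      : (A : Clause) (x : Var) (w : ℚ) → 0ℚ <q w →
               Rule ((A , w) ∷ []) ((A ++ [ pos x ] , w) ∷ (A ++ [ neg x ] , w) ∷ [])
  virtual    : (A : Clause) (w : ℚ) →
               Rule [] ((A , w) ∷ (A , -q w) ∷ [])

-- Free (uncounted) rewriting of a formula as a collection of weighted clauses:
-- reordering, identifying equal clauses, merging (C,u),(C,v) into (C,u+v)
-- and conversely, and disappearance of weight-0 clauses.

data _⇝_ : Formula → Formula → Set where
  perm   : ∀ {F G} → F ↭ G → F ⇝ G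
  rename : ∀ {C D w F} → C ≐ D → ((C , w) ∷ F) ⇝ ((D , w) ∷ F)
  merge  : ∀ {C u v F} → ((C , u) ∷ (C , v) ∷ F) ⇝ ((C , u +q v) ∷ F)
  unmerge : ∀ {C u v w F} → w ≢ 0ℚ → u +q v ≡ w →
            ((C , w) ∷ F) ⇝ ((C , u) ∷ (C , v) ∷ F)
  drop0  : ∀ {C F} → ((C , 0ℚ) ∷ F) ⇝ F

data Free : Formula → Formula → Set where
  ε   : ∀ {F} → Free F F
  _◅_ : ∀ {F G H} → F ⇝ G → Free G H → Free F H

-- F ⟶[ e ] G : a proof F = F₀ ; … ; F_e with F_e (a presentation of) G,
-- using e rule applications (each replacing antecedents by consequents).
data _⟶[_]_ : Formula → ℕ → Formula → Set where
  done : ∀ {F G} → Free F G → F ⟶[ 0 ] G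
  step : ∀ {F Ant Cons R G e} → Free F (Ant ++ R) → Rule Ant Cons →
         (Cons ++ R) ⟶[ e ] G → F ⟶[ suc e ] G

_⊑_ : Formula → Formula → Set
G ⊑ H = All (λ { (C , w) → Any (λ { (C' , w') → (C' ≐ C) × (w ≤q w') }) H }) G

AllPositive : Formula → Set
AllPositive F = All (λ cw → 0ℚ <q proj₂ cw) F

_⊢[_]_ : Formula → ℕ → Formula → Set
F ⊢[ e ] G = ∃[ Fe ] (F ⟶[ e ] Fe) × (G ⊑ Fe) × AllPositive Fe

-- SPHP_m  (indices i ∈ 1..m+1, j ∈ 1..m)

range1 : ℕ → List ℕ
range1 n = map suc (upTo n)

Km : ℕ → List Clause
Km m =
     map (λ i → map (λ j → pos (i , j)) (range1 m)) (range1 (suc m))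
  ++ concatMap (λ j →
       concatMap (λ i' →
         map (λ i → neg (i , j) ∷ neg (i' , j) ∷ []) (range1 (ℕ.pred i')))
         (range1 (suc m)))
       (range1 m)

SPHP : ℕ → Formula
SPHP m = withW 1ℚ (Km m)

-- Virtual weights make a pigeon clause x_{i1} ∨ … ∨ x_{im} refutable on its own:
-- introduce (x̄ᵢⱼ , 1) together with (x̄ᵢⱼ , −1) and resolve; after m resolutions
-- pigeon i has become (□ , 1) plus the debts (x̄ᵢⱼ , −1).  This gives m + 1 copies
-- of □, and hole j spends one of them to repay its m + 1 debts: while □ grows
-- into x_{1j} ∨ … ∨ x_{nj} by splitting on x_{n+1,j}, the x̄_{n+1,j}-half resolves
-- against the hole clauses x̄_{lj} ∨ x̄_{n+1,j} (l ≤ n) down to (x̄_{n+1,j} , 1),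
-- which cancels the debt of pigeon n + 1.  Every other leftover has nonnegative
-- weight, and the proof has (m + 1)·2m + m·(m + 1)² = O(m³) steps.
module Submission where

open import Defs
open import Data.Nat using (ℕ; zero; suc; pred; _≤_; _*_; _^_; _+_; z≤n; s≤s)
import Data.Nat.Properties as ℕ
open import Data.Nat.Tactic.RingSolver using (solve-∀)
open import Data.Product using (∃-syntax; _×_; _,_; proj₂; Σ-syntax)
open import Data.List using (List; []; _∷_; _++_; [_]; map; concatMap; length; upTo)
import Data.List.Properties as List
open import Data.Bool using (true; false)
open import Data.Bool.ListAction using (any)
open import Data.List.Relation.Unary.All using (All; []; _∷_)
import Data.List.Relation.Unary.All as All
import Data.List.Relation.Unary.All.Properties as Allₚ
open import Data.List.Relation.Unary.Any using (here; there)
open import Data.List.Relation.Binary.Permutation.Propositional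
  using (_↭_; ↭-refl; ↭-sym; ↭-trans; ↭-reflexive; prep; module PermutationReasoning)
import Data.List.Relation.Binary.Permutation.Propositional.Properties as ↭
open import Data.Rational using (0ℚ; 1ℚ) renaming (-_ to -q_; _-_ to _-q_; _<_ to _<q_; _≤_ to _≤q_)
import Data.Rational.Properties as ℚ
open import Data.Unit using (⊤; tt)
open import Relation.Nullary using (yes; no; ¬_)
open import Relation.Nullary.Decidable using (isYes≗does; dec-false)
open import Relation.Binary.PropositionalEquality
  using (_≡_; _≢_; refl; sym; trans; cong; cong₂; module ≡-Reasoning)
open import Algebra.Bundles using (CommutativeMonoid)
import Algebra.Properties.CommutativeSemigroup as CommutativeSemigroupProperties

□ : Clause
□ = []

0<1 : 0ℚ <q 1ℚ
0<1 = ℚ.positive⁻¹ 1ℚ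

0≤1 : 0ℚ ≤q 1ℚ
0≤1 = ℚ.<⇒≤ 0<1

NonNegative : Formula → Set
NonNegative = All (λ cw → 0ℚ ≤q proj₂ cw)

withW-1-nonNegative : ∀ Cs → NonNegative (withW 1ℚ Cs)
withW-1-nonNegative Cs = Allₚ.map⁺ (All.universal (λ _ → 0≤1) Cs)

infixr 5 _◅◅_

_◅◅_ : ∀ {F G H} → Free F G → Free G H → Free F H
ε ◅◅ g = g
(s ◅ f) ◅◅ g = s ◅ (f ◅◅ g)

↭⇒Free : ∀ {F G} → F ↭ G → Free F G
↭⇒Free p = perm p ◅ ε

≡⇒Free : ∀ {F G} → F ≡ G → Free F G
≡⇒Free refl = ε

⇝-++⁺ʳ : ∀ {F G} R → F ⇝ G → (F ++ R) ⇝ (G ++ R)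
⇝-++⁺ʳ R (perm p)      = perm (↭.++⁺ʳ R p)
⇝-++⁺ʳ R (rename C≐D)  = rename C≐D
⇝-++⁺ʳ R merge         = merge
⇝-++⁺ʳ R (unmerge w≢0 u+v≡w) = unmerge w≢0 u+v≡w
⇝-++⁺ʳ R drop0         = drop0

Free-++⁺ʳ : ∀ {F G} R → Free F G → Free (F ++ R) (G ++ R)
Free-++⁺ʳ R ε       = ε
Free-++⁺ʳ R (s ◅ f) = ⇝-++⁺ʳ R s ◅ Free-++⁺ʳ R f

Free-++⁺ˡ : ∀ {F G} R → Free F G → Free (R ++ F) (R ++ G)
Free-++⁺ˡ {F} {G} R f =
  ↭⇒Free (↭.++-comm R F) ◅◅ Free-++⁺ʳ R f ◅◅ ↭⇒Free (↭.++-comm G R)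

⟶-pre : ∀ {F G H e} → Free F G → G ⟶[ e ] H → F ⟶[ e ] H
⟶-pre f (done g)     = done (f ◅◅ g)
⟶-pre f (step g r d) = step (f ◅◅ g) r d

⟶-post : ∀ {F G H e} → F ⟶[ e ] G → Free G H → F ⟶[ e ] H
⟶-post (done g)     f = done (g ◅◅ f)
⟶-post (step g r d) f = step g r (⟶-post d f)

⟶-trans : ∀ {F G H e₁ e₂} → F ⟶[ e₁ ] G → G ⟶[ e₂ ] H → F ⟶[ e₁ + e₂ ] H
⟶-trans (done f)     d′ = ⟶-pre f d′
⟶-trans (step f r d) d′ = step f r (⟶-trans d d′)

⟶-++⁺ʳ : ∀ {F G e} R → F ⟶[ e ] G → (F ++ R) ⟶[ e ] (G ++ R)
⟶-++⁺ʳ R (done f) = done (Free-++⁺ʳ R f)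
⟶-++⁺ʳ R (step {Ant = Ant} {Cons} {R′} f r d) =
  step (Free-++⁺ʳ R f ◅◅ ≡⇒Free (List.++-assoc Ant R′ R)) r
       (⟶-pre (≡⇒Free (sym (List.++-assoc Cons R′ R))) (⟶-++⁺ʳ R d))

-- Leftovers of weight 0 vanish and the others may stay in the final formula,
-- so leftovers of nonnegative weight can be ignored.
record _▷[_]_ (F : Formula) (b : ℕ) (G : Formula) : Set where
  constructor derives
  field
    steps      : ℕ
    steps≤     : steps ≤ b
    leftover   : Formula
    leftover≥0 : NonNegative leftover
    derivation : F ⟶[ steps ] (G ++ leftover)

▷-free : ∀ {F G} → Free F G → F ▷[ 0 ] G
▷-free {G = G} f = derives 0 z≤n [] [] (done (f ◅◅ ≡⇒Free (sym (List.++-identityʳ G))))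

▷-pre : ∀ {F F′ G b} → Free F F′ → F′ ▷[ b ] G → F ▷[ b ] G
▷-pre f (derives e e≤b J J≥0 d) = derives e e≤b J J≥0 (⟶-pre f d)

▷-post : ∀ {F G H b} → F ▷[ b ] G → Free G H → F ▷[ b ] H
▷-post (derives e e≤b J J≥0 d) f = derives e e≤b J J≥0 (⟶-post d (Free-++⁺ʳ J f))

▷-rule : ∀ {Ant Cons} → Rule Ant Cons → Ant ▷[ 1 ] Cons
▷-rule {Ant} r =
  derives 1 ℕ.≤-refl [] [] (step (≡⇒Free (sym (List.++-identityʳ Ant))) r (done ε))

▷-discard : ∀ {F G J b} → F ▷[ b ] (G ++ J) → NonNegative J → F ▷[ b ] G
▷-discard {G = G} {J} (derives e e≤b J′ J′≥0 d) J≥0 =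
  derives e e≤b (J ++ J′) (Allₚ.++⁺ J≥0 J′≥0) (⟶-post d (≡⇒Free (List.++-assoc G J J′)))

▷-mono : ∀ {F G b b′} → b ≤ b′ → F ▷[ b ] G → F ▷[ b′ ] G
▷-mono b≤b′ (derives e e≤b J J≥0 d) = derives e (ℕ.≤-trans e≤b b≤b′) J J≥0 d

▷-trans : ∀ {F G H b₁ b₂} → F ▷[ b₁ ] G → G ▷[ b₂ ] H → F ▷[ b₁ + b₂ ] H
▷-trans {H = H} (derives e₁ e₁≤b₁ J₁ J₁≥0 d₁) (derives e₂ e₂≤b₂ J₂ J₂≥0 d₂) =
  derives (e₁ + e₂) (ℕ.+-mono-≤ e₁≤b₁ e₂≤b₂) (J₂ ++ J₁) (Allₚ.++⁺ J₂≥0 J₁≥0)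
    (⟶-trans d₁ (⟶-post (⟶-++⁺ʳ J₁ d₂) (≡⇒Free (List.++-assoc H J₂ J₁))))

▷-++⁺ʳ : ∀ {F G b} R → F ▷[ b ] G → (F ++ R) ▷[ b ] (G ++ R)
▷-++⁺ʳ {G = G} R (derives e e≤b J J≥0 d) =
  derives e e≤b J J≥0 (⟶-post (⟶-++⁺ʳ R d) (↭⇒Free leftover-last))
  where
    open PermutationReasoning
    leftover-last : (G ++ J) ++ R ↭ (G ++ R) ++ J
    leftover-last = begin
      (G ++ J) ++ R  ↭⟨ ↭.++-assoc G J R ⟩
      G ++ (J ++ R)  ↭⟨ ↭.++⁺ˡ G (↭.++-comm J R) ⟩
      G ++ (R ++ J)  ↭⟨ ↭.++-assoc G R J ⟨
      (G ++ R) ++ J  ∎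

▷-++⁺ˡ : ∀ {F G b} R → F ▷[ b ] G → (R ++ F) ▷[ b ] (R ++ G)
▷-++⁺ˡ {F} {G} R F▷G =
  ▷-pre (↭⇒Free (↭.++-comm R F)) (▷-post (▷-++⁺ʳ R F▷G) (↭⇒Free (↭.++-comm G R)))

▷-++⁺ : ∀ {F₁ G₁ F₂ G₂ b₁ b₂} →
  F₁ ▷[ b₁ ] G₁ → F₂ ▷[ b₂ ] G₂ → (F₁ ++ F₂) ▷[ b₁ + b₂ ] (G₁ ++ G₂)
▷-++⁺ {G₁ = G₁} {F₂} F₁▷G₁ F₂▷G₂ = ▷-trans (▷-++⁺ʳ F₂ F₁▷G₁) (▷-++⁺ˡ G₁ F₂▷G₂)

▷-concatMap : ∀ {A : Set} {f g : A → Formula} {b} → (∀ a → f a ▷[ b ] g a) →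
  ∀ xs → concatMap f xs ▷[ length xs * b ] concatMap g xs
▷-concatMap f▷g []       = ▷-free ε
▷-concatMap f▷g (x ∷ xs) = ▷-++⁺ (f▷g x) (▷-concatMap f▷g xs)

drop-zero-weights : ∀ J → NonNegative J → Σ[ J′ ∈ Formula ] Free J J′ × AllPositive J′
drop-zero-weights [] [] = [] , ε , []
drop-zero-weights ((C , w) ∷ J) (0≤w ∷ J≥0) with drop-zero-weights J J≥0 | 0ℚ ℚ.<? w
... | J′ , J⇝J′ , J′>0 | yes 0<w = (C , w) ∷ J′ , Free-++⁺ˡ [ (C , w) ] J⇝J′ , 0<w ∷ J′>0
... | J′ , J⇝J′ , J′>0 | no 0≮w with ℚ.≤-antisym (ℚ.≮⇒≥ 0≮w) 0≤w
...   | refl = J′ , drop0 ◅ J⇝J′ , J′>0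

⊑-++ : ∀ G J → G ⊑ (G ++ J)
⊑-++ []            J = []
⊑-++ ((C , w) ∷ G) J =
  here (((λ C∈ → C∈) , (λ C∈ → C∈)) , ℚ.≤-refl) ∷ All.map (λ { {_ , _} → there }) (⊑-++ G J)

▷⇒⊢ : ∀ {F G b} → AllPositive G → F ▷[ b ] G → ∃[ e ] e ≤ b × F ⊢[ e ] G
▷⇒⊢ {G = G} G>0 (derives e e≤b J J≥0 d) with drop-zero-weights J J≥0
... | J′ , J⇝J′ , J′>0 =
  e , e≤b , G ++ J′ , ⟶-post d (Free-++⁺ˡ G J⇝J′) , ⊑-++ G J′ , Allₚ.++⁺ G>0 J′>0

Holds : (Var → Set) → Lit → Set
Holds P (pos x) = P x
Holds P (neg x) = ¬ P x

any≡false : ∀ {A : Set} {p} (xs : List A) → All (λ x → p x ≡ false) xs → any p xs ≡ false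
any≡false []       []           = refl
any≡false (x ∷ xs) (px≡false ∷ ps) rewrite px≡false = any≡false xs ps

memb≡false : ∀ l C → All (l ≢_) C → memb l C ≡ false
memb≡false l C l∉C =
  any≡false C (All.map (λ {l′} l≢l′ → trans (isYes≗does (l ≟L l′)) (dec-false (l ≟L l′) l≢l′)) l∉C)

compl∉ : ∀ {P l} C → Holds P l → All (Holds P) C → All (compl l ≢_) C
compl∉ {l = pos x} C Px = All.map λ { {pos y} _ () ; {neg y} ¬Py refl → ¬Py Px }
compl∉ {l = neg x} C ¬Px = All.map λ { {pos y} Py refl → ¬Px Py ; {neg y} _ () }

isTaut≡false : ∀ {P} C → All (Holds P) C → isTaut C ≡ false
isTaut≡false C C-holds =
  any≡false C (All.map (λ {l} l-holds → memb≡false (compl l) C (compl∉ C l-holds C-holds)) C-holds)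

dropTaut-nonTaut : ∀ C w F → isTaut C ≡ false → dropTaut ((C , w) ∷ F) ≡ (C , w) ∷ dropTaut F
dropTaut-nonTaut C w F nonTaut with isTaut C
dropTaut-nonTaut C w F refl | false = refl

dropTaut-All : ∀ {Q : WClause → Set} F → All Q F → All Q (dropTaut F)
dropTaut-All []            []       = []
dropTaut-All ((C , w) ∷ F) (q ∷ qs) with isTaut C
... | true  = dropTaut-All F qs
... | false = q ∷ dropTaut-All F qs

-- An assignment satisfying every literal of the resolvent shows that it is not
-- a tautology, so the resolution rule keeps it.
resolve : ∀ {P} x A B → All (Holds P) (A ++ B) →
  ((pos x ∷ A , 1ℚ) ∷ (neg x ∷ B , 1ℚ) ∷ []) ▷[ 1 ] [ (A ++ B , 1ℚ) ]
resolve x A B resolvent-holds =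
  ▷-discard (▷-post (▷-rule (resolution x A B 1ℚ 1ℚ 0<1 0<1)) (≡⇒Free kept))
            (dropTaut-All rest (ℚ.≤-refl ∷ ℚ.≤-refl ∷
               Allₚ.++⁺ (withW-1-nonNegative (negExp (pos x ∷ A) B))
                        (withW-1-nonNegative (negExp (neg x ∷ B) A))))
  where
    rest : Formula
    rest = (pos x ∷ A , 1ℚ -q 1ℚ) ∷ (neg x ∷ B , 1ℚ -q 1ℚ)
         ∷ (withW 1ℚ (negExp (pos x ∷ A) B) ++ withW 1ℚ (negExp (neg x ∷ B) A))
    kept : resCons x A B 1ℚ 1ℚ ≡ [ (A ++ B , 1ℚ) ] ++ dropTaut rest
    kept = dropTaut-nonTaut (A ++ B) 1ℚ rest (isTaut≡false (A ++ B) resolvent-holds)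

cancel : ∀ C → Free ((C , 1ℚ) ∷ (C , -q 1ℚ) ∷ []) []
cancel C = merge ◅ (drop0 ◅ ε)

range1-∷ʳ : ∀ n → range1 (suc n) ≡ range1 n ++ [ suc n ]
range1-∷ʳ n = trans (cong (map suc) (sym (List.upTo-∷ʳ n))) (List.map-++ suc (upTo n) [ n ])

length-range1 : ∀ n → length (range1 n) ≡ n
length-range1 n = trans (List.length-map suc (upTo n)) (List.length-upTo n)

range1-≢ : ∀ n → All (_≢ suc n) (range1 n)
range1-≢ n = Allₚ.map⁺ (All.map (λ i<n → ℕ.<⇒≢ (s≤s i<n)) (Allₚ.all-upTo n))

map≡concatMap-[_] : ∀ {A B : Set} (f : A → B) xs → map f xs ≡ concatMap (λ x → [ f x ]) xs
map≡concatMap-[_] f xs = trans (sym (List.concatMap-pure (map f xs))) (List.concatMap-map [_] f xs)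

row : ℕ → List ℕ → Clause
row i js = map (λ j → pos (i , j)) js

column : ℕ → List ℕ → Clause
column j is = map (λ i → pos (i , j)) is

conflicts : ℕ → ℕ → List ℕ → List Clause
conflicts j k is = map (λ i → neg (i , j) ∷ neg (k , j) ∷ []) is

debt : ℕ → ℕ → WClause
debt i j = ([ neg (i , j) ] , -q 1ℚ)

pigeon : ∀ i js → [ (row i js , 1ℚ) ] ▷[ length js * 2 ] ((□ , 1ℚ) ∷ map (debt i) js)
pigeon i []       = ▷-free ε
pigeon i (j ∷ js) =
  ▷-trans (▷-++⁺ˡ [ (row i (j ∷ js) , 1ℚ) ] (▷-rule (virtual x̄ᵢⱼ 1ℚ)))
  (▷-trans (▷-++⁺ʳ [ debt i j ] (resolve (i , j) (row i js) [] row-holds))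
  (▷-pre (≡⇒Free (cong (λ C → (C , 1ℚ) ∷ [ debt i j ]) (List.++-identityʳ (row i js))))
  (▷-post (▷-++⁺ʳ [ debt i j ] (pigeon i js))
          (↭⇒Free (prep (□ , 1ℚ) (↭.++-comm (map (debt i) js) [ debt i j ]))))))
  where
    x̄ᵢⱼ : Clause
    x̄ᵢⱼ = [ neg (i , j) ]
    row-holds : All (Holds (λ _ → ⊤)) (row i js ++ [])
    row-holds = Allₚ.++⁺ (Allₚ.map⁺ (All.universal (λ _ → tt) js)) []

≐-singleton : ∀ (a : Lit) T → All (_≡ a) T → (a ∷ T) ≐ [ a ]
≐-singleton a T T≡a =
  (λ { (here l≡a) → here l≡a ; (there l∈T) → here (All.lookup T≡a l∈T) }) ,
  (λ { (here l≡a) → here l≡a })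

-- Each resolution appends another copy of x̄ₖⱼ, hence the accumulator T.
resolve-conflicts : ∀ j k is T → All (_≢ k) is → All (_≡ neg (k , j)) T →
  ((column j is ++ neg (k , j) ∷ T , 1ℚ) ∷ withW 1ℚ (conflicts j k is))
    ▷[ length is ] [ ([ neg (k , j) ] , 1ℚ) ]
resolve-conflicts j k [] T [] T≡x̄ = ▷-free (rename (≐-singleton (neg (k , j)) T T≡x̄) ◅ ε)
resolve-conflicts j k (i ∷ is) T (_ ∷ is≢k) T≡x̄ =
  ▷-trans (▷-++⁺ʳ (withW 1ℚ (conflicts j k is))
                  (resolve (i , j) (column j is ++ x̄ ∷ T) [ x̄ ] resolvent-holds))
  (▷-pre (≡⇒Free (cong (λ C → (C , 1ℚ) ∷ withW 1ℚ (conflicts j k is))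
                       (List.++-assoc (column j is) (x̄ ∷ T) [ x̄ ])))
         (resolve-conflicts j k is (T ++ [ x̄ ]) is≢k (Allₚ.++⁺ T≡x̄ (refl ∷ []))))
  where
    x̄ : Lit
    x̄ = neg (k , j)
    trueUnlessK : Var → Set
    trueUnlessK (i , _) = i ≢ k
    x̄-holds : Holds trueUnlessK x̄
    x̄-holds k≢k = k≢k refl
    resolvent-holds : All (Holds trueUnlessK) ((column j is ++ x̄ ∷ T) ++ [ x̄ ])
    resolvent-holds =
      Allₚ.++⁺ (Allₚ.++⁺ (Allₚ.map⁺ is≢k) (x̄-holds ∷ All.map (λ { refl → x̄-holds }) T≡x̄))
               (x̄-holds ∷ [])

holeConflicts : ℕ → ℕ → Formula
holeConflicts j k = withW 1ℚ (conflicts j k (range1 (pred k)))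

holeBlock : ℕ → ℕ → Formula
holeBlock j k = holeConflicts j k ++ [ debt k j ]

column-∷ʳ : ∀ j n → column j (range1 n) ++ [ pos (suc n , j) ] ≡ column j (range1 (suc n))
column-∷ʳ j n =
  sym (trans (cong (column j) (range1-∷ʳ n)) (List.map-++ (λ i → pos (i , j)) (range1 n) [ suc n ]))

hole-step : ∀ j n →
  ((column j (range1 n) , 1ℚ) ∷ holeBlock j (suc n)) ▷[ suc n ] [ (column j (range1 (suc n)) , 1ℚ) ]
hole-step j n =
  ▷-mono (ℕ.≤-reflexive (cong suc (length-range1 n)))
  (▷-trans (▷-post (▷-++⁺ʳ (holeBlock j (suc n))
                             (▷-rule (split (column j (range1 n)) (suc n , j) 1ℚ 0<1)))
                   (≡⇒Free (cong (λ C → (C , 1ℚ) ∷ split-half) (column-∷ʳ j n))))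
           (▷-++⁺ˡ [ (column j (range1 (suc n)) , 1ℚ) ]
              (▷-post (▷-++⁺ʳ [ debt (suc n) j ]
                         (resolve-conflicts j (suc n) (range1 n) [] (range1-≢ n) []))
                      (cancel [ neg (suc n , j) ]))))
  where
    split-half : Formula
    split-half = (column j (range1 n) ++ [ neg (suc n , j) ] , 1ℚ) ∷ holeBlock j (suc n)

square-step : ∀ n → n * n + suc n ≤ suc n * suc n
square-step n = ℕ.≤-trans (ℕ.m≤m+n (n * n + suc n) n) (ℕ.≤-reflexive (expand n))
  where
    expand : ∀ n → n * n + suc n + n ≡ suc n * suc n
    expand = solve-∀

holeBlocks-∷ʳ : ∀ j n →
  concatMap (holeBlock j) (range1 (suc n)) ≡ concatMap (holeBlock j) (range1 n) ++ holeBlock j (suc n)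
holeBlocks-∷ʳ j n = begin
  concatMap (holeBlock j) (range1 (suc n))
    ≡⟨ cong (concatMap (holeBlock j)) (range1-∷ʳ n) ⟩
  concatMap (holeBlock j) (range1 n ++ [ suc n ])
    ≡⟨ List.concatMap-++ (holeBlock j) (range1 n) [ suc n ] ⟩
  concatMap (holeBlock j) (range1 n) ++ (holeBlock j (suc n) ++ [])
    ≡⟨ cong (concatMap (holeBlock j) (range1 n) ++_) (List.++-identityʳ (holeBlock j (suc n))) ⟩
  concatMap (holeBlock j) (range1 n) ++ holeBlock j (suc n) ∎
  where open ≡-Reasoning

hole : ∀ j n →
  ((□ , 1ℚ) ∷ concatMap (holeBlock j) (range1 n)) ▷[ n * n ] [ (column j (range1 n) , 1ℚ) ]
hole j zero    = ▷-free ε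
hole j (suc n) =
  ▷-pre (≡⇒Free (cong ((□ , 1ℚ) ∷_) (holeBlocks-∷ʳ j n)))
        (▷-mono (square-step n)
                (▷-trans (▷-++⁺ʳ (holeBlock j (suc n)) (hole j n)) (hole-step j n)))

module _ {A B : Set} where
  open CommutativeSemigroupProperties
    (CommutativeMonoid.commutativeSemigroup (↭.++-commutativeMonoid {A = B}))
    using (interchange)

  concatMap-const-[] : ∀ (xs : List A) → concatMap {B = B} (λ _ → []) xs ≡ []
  concatMap-const-[] []       = refl
  concatMap-const-[] (x ∷ xs) = concatMap-const-[] xs

  concatMap-↭ : ∀ {f g : A → List B} → (∀ x → f x ↭ g x) → ∀ xs → concatMap f xs ↭ concatMap g xs
  concatMap-↭ f↭g []       = ↭-refl
  concatMap-↭ f↭g (x ∷ xs) = ↭.++⁺ (f↭g x) (concatMap-↭ f↭g xs)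

  concatMap-++ᶠ : ∀ (f g : A → List B) xs →
    concatMap (λ x → f x ++ g x) xs ↭ concatMap f xs ++ concatMap g xs
  concatMap-++ᶠ f g []       = ↭-refl
  concatMap-++ᶠ f g (x ∷ xs) =
    ↭-trans (↭.++⁺ˡ (f x ++ g x) (concatMap-++ᶠ f g xs)) (interchange (f x) (g x) _ _)

concatMap-swap : ∀ {A B C : Set} (h : A → B → List C) xs ys →
  concatMap (λ x → concatMap (h x) ys) xs ↭ concatMap (λ y → concatMap (λ x → h x y) xs) ys
concatMap-swap h []       ys = ↭-reflexive (sym (concatMap-const-[] ys))
concatMap-swap h (x ∷ xs) ys =
  ↭-trans (↭.++⁺ˡ (concatMap (h x) ys) (concatMap-swap h xs ys))
          (↭-sym (concatMap-++ᶠ (h x) (λ y → concatMap (λ x → h x y) xs) ys))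

SPHP-split : ∀ m → SPHP m ≡
  concatMap (λ i → [ (row i (range1 m) , 1ℚ) ]) (range1 (suc m)) ++
  concatMap (λ j → concatMap (holeConflicts j) (range1 (suc m))) (range1 m)
SPHP-split m = begin
  withW 1ℚ (map (λ i → row i R) R₁ ++ concatMap conflictClauses R)
    ≡⟨ List.map-++ unit (map (λ i → row i R) R₁) (concatMap conflictClauses R) ⟩
  withW 1ℚ (map (λ i → row i R) R₁) ++ withW 1ℚ (concatMap conflictClauses R)
    ≡⟨ cong₂ _++_ pigeonClauses holeClauses ⟩
  concatMap (λ i → [ (row i R , 1ℚ) ]) R₁ ++ concatMap (λ j → concatMap (holeConflicts j) R₁) R ∎
  where
    open ≡-Reasoning
    R R₁ : List ℕ
    R = range1 m
    R₁ = range1 (suc m)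
    unit : Clause → WClause
    unit C = (C , 1ℚ)
    conflictClauses : ℕ → List Clause
    conflictClauses j = concatMap (λ k → conflicts j k (range1 (pred k))) R₁
    pigeonClauses : withW 1ℚ (map (λ i → row i R) R₁) ≡ concatMap (λ i → [ (row i R , 1ℚ) ]) R₁
    pigeonClauses = trans (sym (List.map-∘ R₁)) (map≡concatMap-[_] (λ i → (row i R , 1ℚ)) R₁)
    holeClauses :
      withW 1ℚ (concatMap conflictClauses R) ≡ concatMap (λ j → concatMap (holeConflicts j) R₁) R
    holeClauses = trans (List.map-concatMap unit conflictClauses R)
      (List.concatMap-cong (λ j → List.map-concatMap unit (λ k → conflicts j k (range1 (pred k))) R₁) R)

reassign-debts : ∀ m →
  concatMap (λ i → (□ , 1ℚ) ∷ map (debt i) (range1 m)) (range1 (suc m)) ++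
  concatMap (λ j → concatMap (holeConflicts j) (range1 (suc m))) (range1 m)
  ↭ (□ , 1ℚ) ∷ concatMap (λ j → (□ , 1ℚ) ∷ concatMap (holeBlock j) (range1 (suc m))) (range1 m)
reassign-debts m = begin
  concatMap (λ i → e ∷ map (debt i) R) R₁ ++ concatMap H R
    ↭⟨ ↭.++⁺ʳ (concatMap H R) (concatMap-++ᶠ (λ _ → [ e ]) (λ i → map (debt i) R) R₁) ⟩
  (copies R₁ ++ concatMap (λ i → map (debt i) R) R₁) ++ concatMap H R
    ≡⟨ cong (λ X → (copies R₁ ++ X) ++ concatMap H R)
            (List.concatMap-cong (λ i → map≡concatMap-[_] (debt i) R) R₁) ⟩
  (copies R₁ ++ concatMap (λ i → concatMap (λ j → [ debt i j ]) R) R₁) ++ concatMap H R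
    ↭⟨ ↭.++⁺ʳ (concatMap H R) (↭.++⁺ one-copy-more (concatMap-swap (λ i j → [ debt i j ]) R₁ R)) ⟩
  e ∷ ((copies R ++ concatMap D R) ++ concatMap H R)
    ↭⟨ prep e regroup ⟩
  e ∷ concatMap (λ j → e ∷ (D j ++ H j)) R
    ↭⟨ prep e (concatMap-↭ (λ j → prep e (debts-last j)) R) ⟩
  e ∷ concatMap (λ j → e ∷ concatMap (holeBlock j) R₁) R ∎
  where
    open PermutationReasoning
    R R₁ : List ℕ
    R = range1 m
    R₁ = range1 (suc m)
    e : WClause
    e = (□ , 1ℚ)
    copies : List ℕ → Formula
    copies = concatMap (λ _ → [ e ])
    D H : ℕ → Formula
    D j = concatMap (λ i → [ debt i j ]) R₁
    H j = concatMap (holeConflicts j) R₁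
    one-copy-more : copies R₁ ↭ e ∷ copies R
    one-copy-more = begin
      copies R₁              ≡⟨ cong copies (range1-∷ʳ m) ⟩
      copies (R ++ [ suc m ]) ≡⟨ List.concatMap-++ (λ _ → [ e ]) R [ suc m ] ⟩
      copies R ++ [ e ]      ↭⟨ ↭.++-comm (copies R) [ e ] ⟩
      e ∷ copies R           ∎
    regroup : (copies R ++ concatMap D R) ++ concatMap H R ↭ concatMap (λ j → e ∷ (D j ++ H j)) R
    regroup = begin
      (copies R ++ concatMap D R) ++ concatMap H R
        ↭⟨ ↭.++-assoc (copies R) (concatMap D R) (concatMap H R) ⟩
      copies R ++ (concatMap D R ++ concatMap H R)
        ↭⟨ ↭.++⁺ˡ (copies R) (concatMap-++ᶠ D H R) ⟨
      copies R ++ concatMap (λ j → D j ++ H j) R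
        ↭⟨ concatMap-++ᶠ (λ _ → [ e ]) (λ j → D j ++ H j) R ⟨
      concatMap (λ j → e ∷ (D j ++ H j)) R ∎
    debts-last : ∀ j → D j ++ H j ↭ concatMap (holeBlock j) R₁
    debts-last j = ↭-trans (↭.++-comm (D j) (H j))
                           (↭-sym (concatMap-++ᶠ (holeConflicts j) (λ k → [ debt k j ]) R₁))

sphp-refutation : ∀ m → SPHP m ▷[ suc m * (m * 2) + m * (suc m * suc m) ] [ (□ , 1ℚ) ]
sphp-refutation m =
  ▷-mono (ℕ.≤-reflexive (cong₂ (λ n₁ n → n₁ * (n * 2) + n * (suc m * suc m))
                               (length-range1 (suc m)) (length-range1 m)))
  (▷-pre (≡⇒Free (SPHP-split m))
  (▷-trans (▷-post (▷-++⁺ʳ (concatMap (λ j → concatMap (holeConflicts j) R₁) R)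
                           (▷-concatMap (λ i → pigeon i R) R₁))
                   (↭⇒Free (reassign-debts m)))
           (▷-post (▷-++⁺ˡ [ (□ , 1ℚ) ] (▷-concatMap holes-repaid R))
                   (≡⇒Free (cong ((□ , 1ℚ) ∷_) (concatMap-const-[] R))))))
  where
    R R₁ : List ℕ
    R = range1 m
    R₁ = range1 (suc m)
    holes-repaid : ∀ j → ((□ , 1ℚ) ∷ concatMap (holeBlock j) R₁) ▷[ suc m * suc m ] []
    holes-repaid j = ▷-discard {G = []} (hole j (suc m)) (0≤1 ∷ [])

refutation-length≤ : ∀ m → 1 ≤ m → suc m * (m * 2) + m * (suc m * suc m) ≤ 16 * m ^ 3
refutation-length≤ m 1≤m = begin
  suc m * (m * 2) + m * (suc m * suc m)  ≤⟨ ℕ.+-mono-≤ (ℕ.*-mono-≤ 1+m≤2m (ℕ.*-mono-≤ m≤2m 2≤2m))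
                                                      (ℕ.*-mono-≤ m≤2m (ℕ.*-mono-≤ 1+m≤2m 1+m≤2m)) ⟩
  2m * (2m * 2m) + 2m * (2m * 2m)        ≡⟨ cube m ⟩
  16 * m ^ 3                             ∎
  where
    open ℕ.≤-Reasoning
    2m : ℕ
    2m = 2 * m
    -- m ^ 3 unfolds to m * (m * (m * 1)); the solver does not accept _^_ here.
    cube : ∀ m → 2 * m * (2 * m * (2 * m)) + 2 * m * (2 * m * (2 * m)) ≡ 16 * (m * (m * (m * 1)))
    cube = solve-∀
    m≤2m : m ≤ 2m
    m≤2m = ℕ.m≤m+n m (m + 0)
    1+m≤2m : suc m ≤ 2m
    1+m≤2m = ℕ.+-mono-≤ 1≤m (ℕ.m≤m+n m 0)
    2≤2m : 2 ≤ 2m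
    2≤2m = ℕ.*-monoʳ-≤ 2 1≤m

mainTheorem19 : ∃[ c ] ∃[ d ] ((m : ℕ) → 1 ≤ m →
                  ∃[ e ] (e ≤ c * m ^ d) × (SPHP m ⊢[ e ] (([] , 1ℚ) ∷ [])))
mainTheorem19 = 16 , 3 , λ m 1≤m →
  let (e , e≤length , proof) = ▷⇒⊢ (0<1 ∷ []) (sphp-refutation m)
  in  e , ℕ.≤-trans e≤length (refutation-length≤ m 1≤m) , proof
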